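{- Let $R$ be a digraph on $k$ vertices and suppose that $F=V_1\ldots V_k$ is a directed Hamilton cycle in $R$. Let $\mathcal{P}=\{P_1,\ldots,P_s\}$ be a collection of arbitrarily oriented paths each on $t$ vertices, and let $\mathcal{Q}$ be a collection of pairwise disjoint oriented subpaths of the $P_i$. Then for any $\gamma>0$ and all sufficiently large $s$ (in terms of $\gamma$ and $k$), there exists a map $\phi:[s]\to V(R)$ such that, if the paths in $\mathcal{P}$ are greedily embedded around $F$ with the embedding of each $P_i$ starting at $\phi(i)$, then for all $V_i\in V(R)$ $$\left|a(i)-\frac{st}{k}\right|\leq\gamma st \quad\text{and}\quad \left|n(i,\mathcal{Q})-\frac{|\mathcal{Q}|}{k}\right|\leq\gamma st.$$
   Context: Indices of clusters are taken modulo $k$. Each path $P_i=u_1u_2\ldots u_t$ has a designated initial vertex $u_1$ and each edge oriented either forward ($u_ju_{j+1}$) or backward ($u_{j+1}u_j$). Greedily embedding $P_i$ around $F$ starting at $V_j$ means: $u_1$ is assigned to $V_j$, and if $u_\ell$ is assigned to $V_p$ then $u_{\ell+1}$ is assigned to $V_{p+1}$ if the edge between $u_\ell,u_{\ell+1}$ is forward and to $V_{p-1}$ if it is backward. $a(i)$ is the total number of vertices of $\bigcup\mathcal{P}$ assigned to $V_i$, and $n(i,\mathcal{Q})$ is the number of subpaths in $\mathcal{Q}$ whose initial vertex is assigned to $V_i$.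
   Formalization: The parameter γ ranges over the positive rationals. -}

module Defs where

open import Data.Nat using (ℕ; zero; suc; _+_; _*_; _<_; _≤_; NonZero)
open import Data.Nat.Properties using (_≟_; _<?_)
open import Data.Integer as ℤ using (ℤ; +_; -[1+_])
open import Data.Integer.DivMod using (_%ℕ_)
open import Data.Fin using (Fin; toℕ)
open import Data.Bool using (Bool; true; false)
open import Data.List using (List; length; []; _∷_)
open import Data.List.Relation.Unary.AllPairs using (AllPairs)
open import Data.Product using (Σ; _×_; _,_; proj₁; proj₂)
open import Data.Sum using (_⊎_)
open import Relation.Binary.PropositionalEquality using (_≡_; _≢_)
open import Relation.Nullary using (¬_)

-- Clusters V_1 … V_k of the Hamilton cycle F are identified with Fin k,
-- in cycle order: V_j is followed by V_{j+1 mod k}.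

cycSuc : (k : ℕ) → .{{_ : NonZero k}} → Fin k → ℕ
cycSuc k j = (+ suc (toℕ j)) %ℕ k

-- R is a digraph on vertex set Fin k (adjacency relation R u v : u → v),
-- and the cyclic order V_1 … V_k (= 0 … k-1) is a directed Hamilton cycle in R.
IsHamCycleOrder : (k : ℕ) → .{{_ : NonZero k}} → (Fin k → Fin k → Set) → Set
IsHamCycleOrder k R = ∀ (j j' : Fin k) → toℕ j' ≡ cycSuc k j → R j j'

-- An arbitrarily oriented path P_i = u_0 u_1 … u_{t-1}; its orientation is
-- given by  o : ℕ → Bool  where  o m = true  iff the edge between u_m and u_{m+1}
-- is forward (u_m → u_{m+1}); only the values m < t-1 are relevant.
Orientation : Set
Orientation = ℕ → Bool

step : Bool → ℤ
step true  = + 1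
step false = -[1+ 0 ]

disp : Orientation → ℕ → ℤ
disp o zero    = + 0
disp o (suc ℓ) = disp o ℓ ℤ.+ step (o ℓ)

greedy : (k : ℕ) → .{{_ : NonZero k}} → Fin k → Orientation → ℕ → ℕ
greedy k j o ℓ = ((+ toℕ j) ℤ.+ disp o ℓ) %ℕ k

countUpTo : (ℕ → ℕ) → ℕ → ℕ → ℕ
countUpTo f c zero = 0
countUpTo f c (suc t) with f t ≟ c
... | Relation.Nullary.yes _ = suc (countUpTo f c t)
... | Relation.Nullary.no  _ = countUpTo f c t

sumFin : (s : ℕ) → (Fin s → ℕ) → ℕ
sumFin zero    f = 0
sumFin (suc s) f = f Fin.zero + sumFin s (λ i → f (Fin.suc i))
  where import Data.Fin as Fin

aCount : (k : ℕ) → .{{_ : NonZero k}} → (s t : ℕ) →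
         (Fin s → Orientation) → (Fin s → Fin k) → Fin k → ℕ
aCount k s t ori φ i = sumFin s (λ p → countUpTo (greedy k (φ p) (ori p)) (toℕ i) t)

-- An oriented subpath of some P_p: (p , a , b) denotes the subpath of P_p on
-- the vertices u_min(a,b) … u_max(a,b), with designated initial vertex u_a.
Subpath : ℕ → Set
Subpath s = Fin s × ℕ × ℕ

path : ∀ {s} → Subpath s → Fin s
path (p , _ , _) = p

start : ∀ {s} → Subpath s → ℕ
start (_ , a , _) = a

finish : ∀ {s} → Subpath s → ℕ
finish (_ , _ , b) = b

OnSubpath : ∀ {s} → Subpath s → Fin s → ℕ → Set
OnSubpath q p ℓ = path q ≡ p × ((start q ≤ ℓ × ℓ ≤ finish q) ⊎ (finish q ≤ ℓ × ℓ ≤ start q))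

ValidSubpath : ∀ {s} → ℕ → Subpath s → Set
ValidSubpath t q = start q < t × finish q < t

Disjoint : ∀ {s} → Subpath s → Subpath s → Set
Disjoint q q' = ∀ p ℓ → OnSubpath q p ℓ → ¬ OnSubpath q' p ℓ

nCount : (k : ℕ) → .{{_ : NonZero k}} → (s : ℕ) →
         (Fin s → Orientation) → (Fin s → Fin k) → List (Subpath s) → Fin k → ℕ
nCount k s ori φ [] i = 0
nCount k s ori φ (q ∷ Q) i with greedy k (φ (path q)) (ori (path q)) (start q) ≟ toℕ i
... | Relation.Nullary.yes _ = suc (nCount k s ori φ Q i)
... | Relation.Nullary.no  _ = nCount k s ori φ Q i

module Submission where

-- The starting clusters are chosen one path at a time by the method of conditional
-- expectations. Rotating the starting cluster of a path rotates its greedy embedding, so over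
-- the k possible starts every cluster receives each vertex of the path, and each initial vertex
-- of a subpath in 𝒬, exactly once. For the potential Σ_c (k·load(c) − total)², averaging over
-- the starts of the next path therefore kills the cross terms and adds at most 2k·(kt)²: a path
-- carries at most t initial vertices of 𝒬, because disjoint subpaths have distinct initial
-- vertices. Some start is no worse than the average, so at the end every |k·a(i) − st| and
-- |k·n(i,𝒬) − |𝒬|| is at most k·t·√(2ks), which is at most γ·k·st once s ≥ 2k/γ².

open import Data.Nat using (ℕ; NonZero)
open import Data.Fin using (Fin)
open import Defs using (Orientation)

module IntegerSums where

  open import Data.Nat using (zero; suc)
  open import Data.Integer using (ℤ; +_; 0ℤ; _+_; _*_; -_; _≤_; _<_; _≤?_)
  open import Data.Integer.Properties
  open import Data.Fin using (zero; suc)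
  open import Data.Fin.Properties using (any?)
  open import Data.Product using (∃-syntax; _,_)
  open import Function using (_∘_)
  open import Relation.Binary.PropositionalEquality
  open import Relation.Nullary using (yes; no; contradiction)
  open import Defs using (sumFin)

  open import Algebra.Properties.Semiring.Sum +-*-semiring public
    using (sum; sum-syntax; sum-cong-≗; sum-replicate-zero; ∑-distrib-+; ∑-comm; *-distribˡ-sum)

  +-sumFin : ∀ n (f : Fin n → ℕ) → + sumFin n f ≡ ∑[ i < n ] (+ f i)
  +-sumFin zero    f = refl
  +-sumFin (suc n) f = trans (pos-+ (f zero) _) (cong (λ y → + f zero + y) (+-sumFin n (f ∘ suc)))

  ∑-const : ∀ n x → ∑[ i < n ] x ≡ + n * x
  ∑-const zero    x = refl
  ∑-const (suc n) x = begin
    x + ∑[ i < n ] x   ≡⟨ cong₂ _+_ (sym (*-identityˡ x)) (∑-const n x) ⟩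
    + 1 * x + + n * x  ≡⟨ *-distribʳ-+ x (+ 1) (+ n) ⟨
    + suc n * x        ∎
    where open ≡-Reasoning

  ∑-neg : ∀ n (f : Fin n → ℤ) → ∑[ i < n ] (- f i) ≡ - ∑[ i < n ] f i
  ∑-neg zero    f = refl
  ∑-neg (suc n) f = trans (cong (λ y → - f zero + y) (∑-neg n (f ∘ suc))) (sym (neg-distrib-+ (f zero) _))

  ∑-mono-≤ : ∀ {n} {f g : Fin n → ℤ} → (∀ i → f i ≤ g i) → sum f ≤ sum g
  ∑-mono-≤ {zero}  f≤g = ≤-refl
  ∑-mono-≤ {suc n} f≤g = +-mono-≤ (f≤g zero) (∑-mono-≤ (f≤g ∘ suc))

  ∑-mono-< : ∀ {n} .{{_ : NonZero n}} {f g : Fin n → ℤ} → (∀ i → f i < g i) → sum f < sum g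
  ∑-mono-< {suc n} f<g = +-mono-<-≤ (f<g zero) (∑-mono-≤ (<⇒≤ ∘ f<g ∘ suc))

  ∑-nonNeg : ∀ {n} {f : Fin n → ℤ} → (∀ i → 0ℤ ≤ f i) → 0ℤ ≤ sum f
  ∑-nonNeg {n} {f} 0≤f = subst (_≤ sum f) (sum-replicate-zero n) (∑-mono-≤ 0≤f)

  term≤∑ : ∀ {n} {f : Fin n → ℤ} → (∀ i → 0ℤ ≤ f i) → ∀ i → f i ≤ sum f
  term≤∑ {suc n} {f} 0≤f zero    =
    subst (_≤ sum f) (+-identityʳ (f zero)) (+-monoʳ-≤ (f zero) (∑-nonNeg (0≤f ∘ suc)))
  term≤∑ {suc n} {f} 0≤f (suc i) = ≤-trans (term≤∑ (0≤f ∘ suc) i)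
    (subst (_≤ sum f) (+-identityˡ (sum (f ∘ suc))) (+-monoˡ-≤ (sum (f ∘ suc)) (0≤f zero)))

  ∑≤n*b⇒∃≤b : ∀ {n} .{{_ : NonZero n}} (f : Fin n → ℤ) b → sum f ≤ + n * b → ∃[ i ] f i ≤ b
  ∑≤n*b⇒∃≤b {n} f b ∑f≤n*b with any? (λ i → f i ≤? b)
  ... | yes found = found
  ... | no  none  = contradiction ∑f≤n*b
    (<⇒≱ (subst (_< sum f) (∑-const n b) (∑-mono-< (λ i → ≰⇒> (none ∘ (i ,_))))))

module Counting where

  open import Data.Nat using (zero; suc)
  open import Data.Nat.Properties using (_≟_)
  open import Data.Integer using (ℤ; +_; 0ℤ; 1ℤ; _+_; _*_)
  open import Data.Integer.Properties using (*-identityˡ; *-identityʳ; +-identityʳ; +-identityˡ)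
  open import Data.Bool using (if_then_else_; true; false)
  open import Data.Fin using (zero; suc)
  import Data.Fin.Properties as Finₚ
  open import Data.List using (List; _∷_; length; filter; downFrom)
  open import Function using (_∘_)
  open import Relation.Unary using (Decidable)
  open import Relation.Binary.PropositionalEquality
  open import Relation.Nullary using (Dec; does; yes; no; ¬_; contradiction)
  open import Defs using (countUpTo)
  open IntegerSums

  𝟙 : ∀ {a} {A : Set a} → Dec A → ℤ
  𝟙 A? = if does A? then 1ℤ else 0ℤ

  𝟙-cong : ∀ {a b} {A : Set a} {B : Set b} → (A → B) → (B → A) → (A? : Dec A) (B? : Dec B) → 𝟙 A? ≡ 𝟙 B?
  𝟙-cong A→B B→A (yes a) (yes b) = refl
  𝟙-cong A→B B→A (yes a) (no ¬b) = contradiction (A→B a) ¬b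
  𝟙-cong A→B B→A (no ¬a) (yes b) = contradiction (B→A b) ¬a
  𝟙-cong A→B B→A (no ¬a) (no ¬b) = refl

  𝟙-yes : ∀ {a} {A : Set a} (A? : Dec A) → A → 𝟙 A? ≡ 1ℤ
  𝟙-yes (yes _) _ = refl
  𝟙-yes (no ¬a) a = contradiction a ¬a

  𝟙-no : ∀ {a} {A : Set a} (A? : Dec A) → ¬ A → 𝟙 A? ≡ 0ℤ
  𝟙-no (yes a) ¬a = contradiction a ¬a
  𝟙-no (no _)  _  = refl

  ∑-𝟙-≟-* : ∀ {n} (r : Fin n) (g : Fin n → ℤ) → ∑[ j < n ] (𝟙 (r Finₚ.≟ j) * g j) ≡ g r
  ∑-𝟙-≟-* {suc n} zero    g =
    trans (cong₂ _+_ (*-identityˡ (g zero)) (sum-replicate-zero n)) (+-identityʳ (g zero))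
  ∑-𝟙-≟-* {suc n} (suc r) g = trans (+-identityˡ _) (∑-𝟙-≟-* r (g ∘ suc))

  ∑-𝟙-≟ : ∀ {n} (r : Fin n) → ∑[ j < n ] 𝟙 (r Finₚ.≟ j) ≡ 1ℤ
  ∑-𝟙-≟ r = trans (sum-cong-≗ (λ j → sym (*-identityʳ (𝟙 (r Finₚ.≟ j))))) (∑-𝟙-≟-* r (λ _ → 1ℤ))

  +length-filter-∷ : ∀ {a p} {A : Set a} {P : A → Set p} (P? : Decidable P) x xs →
    + length (filter P? (x ∷ xs)) ≡ 𝟙 (P? x) + + length (filter P? xs)
  +length-filter-∷ P? x xs with does (P? x)
  ... | true  = refl
  ... | false = refl

  hits : (ℕ → ℕ) → ℕ → List ℕ → ℕ
  hits f c = length ∘ filter (λ ℓ → f ℓ ≟ c)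

  +countUpTo≡hits-downFrom : ∀ f c t → + countUpTo f c t ≡ + hits f c (downFrom t)
  +countUpTo≡hits-downFrom f c zero    = refl
  +countUpTo≡hits-downFrom f c (suc t) = begin
    + countUpTo f c (suc t)                ≡⟨ +countUpTo-suc ⟩
    𝟙 (f t ≟ c) + + countUpTo f c t        ≡⟨ cong (_+_ (𝟙 (f t ≟ c))) (+countUpTo≡hits-downFrom f c t) ⟩
    𝟙 (f t ≟ c) + + hits f c (downFrom t)  ≡⟨ +length-filter-∷ (λ ℓ → f ℓ ≟ c) t (downFrom t) ⟨
    + hits f c (downFrom (suc t))          ∎
    where
    open ≡-Reasoning
    +countUpTo-suc : + countUpTo f c (suc t) ≡ 𝟙 (f t ≟ c) + + countUpTo f c t
    +countUpTo-suc with f t ≟ c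
    ... | yes ft≡c = sym (cong (λ x → x + + countUpTo f c t) (𝟙-yes (f t ≟ c) ft≡c))
    ... | no  ft≢c = sym (cong (λ x → x + + countUpTo f c t) (𝟙-no (f t ≟ c) ft≢c))

module Remainder (k : ℕ) .{{_ : NonZero k}} where

  open import Data.Nat as ℕ using (zero; suc; _<_)
  import Data.Nat.Properties as ℕ
  open import Data.Integer using (ℤ; +_; _+_; _*_; _-_; -_; ∣_∣; _⊖_)
  open import Data.Integer.Properties
    using (m-n≡m⊖n; abs-*; ∣m⊝n∣≤m⊔n; ∣i∣≡0⇒i≡0; i-j≡0⇒i≡j; +-injective)
  open import Data.Integer.DivMod using (_%ℕ_; _/ℕ_; a≡a%ℕn+[a/ℕn]*n; n%ℕd<d)
  open import Data.Integer.Tactic.RingSolver using (solve-∀)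
  open import Relation.Binary.PropositionalEquality
  open import Relation.Nullary using (contradiction)

  -- If a = r′ + q′k is the division of a by k, then |q − q′|·k = |r′ − r| < k forces q = q′.
  %ℕ-unique : ∀ {a r} (q : ℤ) → r < k → a ≡ + r + q * + k → a %ℕ k ≡ r
  %ℕ-unique {a} {r} q r<k a≡r+qk =
    +-injective (i-j≡0⇒i≡j (+ r′) (+ r) (trans (m-n≡m⊖n r′ r) (∣i∣≡0⇒i≡0 ∣r′⊖r∣≡0)))
    where
    r′ = a %ℕ k
    q′ = a /ℕ k
    r′-r≡[q-q′]k : + r′ - + r ≡ (q - q′) * + k
    r′-r≡[q-q′]k = begin
      + r′ - + r                                            ≡⟨ regroup (+ r′) (+ r) q q′ (+ k) ⟩
      (+ r′ + q′ * + k) - (+ r + q * + k) + (q - q′) * + k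
        ≡⟨ cong₂ (λ x y → x - y + (q - q′) * + k) (sym (a≡a%ℕn+[a/ℕn]*n a k)) (sym a≡r+qk) ⟩
      a - a + (q - q′) * + k                                ≡⟨ cancel a ((q - q′) * + k) ⟩
      (q - q′) * + k                                        ∎
      where
      open ≡-Reasoning
      regroup : ∀ r′ r q q′ K → r′ - r ≡ (r′ + q′ * K) - (r + q * K) + (q - q′) * K
      regroup = solve-∀
      cancel : ∀ a x → a - a + x ≡ x
      cancel = solve-∀
    ∣r′⊖r∣≡∣q-q′∣*k : ∣ r′ ⊖ r ∣ ≡ ∣ q - q′ ∣ ℕ.* k
    ∣r′⊖r∣≡∣q-q′∣*k =
      trans (cong ∣_∣ (trans (sym (m-n≡m⊖n r′ r)) r′-r≡[q-q′]k)) (abs-* (q - q′) (+ k))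
    ∣r′⊖r∣<k : ∣ r′ ⊖ r ∣ < k
    ∣r′⊖r∣<k = ℕ.≤-<-trans (∣m⊝n∣≤m⊔n r′ r) (ℕ.⊔-pres-<m (n%ℕd<d a k) r<k)
    n*k<k⇒n≡0 : ∀ n → n ℕ.* k < k → n ≡ 0
    n*k<k⇒n≡0 zero    _    = refl
    n*k<k⇒n≡0 (suc n) nk<k = contradiction nk<k (ℕ.≤⇒≯ (ℕ.m≤m+n k (n ℕ.* k)))
    ∣r′⊖r∣≡0 : ∣ r′ ⊖ r ∣ ≡ 0
    ∣r′⊖r∣≡0 = trans ∣r′⊖r∣≡∣q-q′∣*k
      (cong (ℕ._* k) (n*k<k⇒n≡0 ∣ q - q′ ∣ (subst (_< k) ∣r′⊖r∣≡∣q-q′∣*k ∣r′⊖r∣<k)))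

  %ℕ-transpose : ∀ {a r} (e : ℤ) → a < k → (+ a + e) %ℕ k ≡ r → (+ r - e) %ℕ k ≡ a
  %ℕ-transpose {a} {r} e a<k [a+e]%k≡r = %ℕ-unique (- q) a<k (begin
    + r - e                                       ≡⟨ cong (λ x → + x - e) [a+e]%k≡r ⟨
    + ((+ a + e) %ℕ k) - e                        ≡⟨ shift (+ ((+ a + e) %ℕ k)) q (+ k) e ⟩
    (+ ((+ a + e) %ℕ k) + q * + k) - e - q * + k
      ≡⟨ cong (λ x → x - e - q * + k) (a≡a%ℕn+[a/ℕn]*n (+ a + e) k) ⟨
    (+ a + e) - e - q * + k                       ≡⟨ cancel (+ a) e q (+ k) ⟩
    + a + - q * + k                               ∎)
    where
    open ≡-Reasoning
    q = (+ a + e) /ℕ k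
    shift : ∀ R q K e → R - e ≡ (R + q * K) - e - q * K
    shift = solve-∀
    cancel : ∀ a e q K → (a + e) - e - q * K ≡ a + - q * K
    cancel = solve-∀

module GreedyEmbedding (k : ℕ) .{{_ : NonZero k}} where

  open import Data.Nat.Properties using (_≟_)
  open import Data.Integer using (+_; 1ℤ; _+_; _-_; -_)
  open import Data.Integer.Properties using (neg-involutive)
  open import Data.Integer.DivMod using (_%ℕ_; n%ℕd<d)
  open import Data.Fin using (toℕ; fromℕ<)
  open import Data.Fin.Properties using (toℕ<n; toℕ-fromℕ<; toℕ-injective)
  import Data.Fin.Properties as Finₚ
  open import Data.List using (List; []; _∷_; length)
  open import Relation.Binary.PropositionalEquality
  open import Defs using (disp; greedy)
  open IntegerSums
  open Counting
  open Remainder k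

  ∑-𝟙-greedy≡ : ∀ o ℓ (c : Fin k) → ∑[ j < k ] 𝟙 (greedy k j o ℓ ≟ toℕ c) ≡ 1ℤ
  ∑-𝟙-greedy≡ o ℓ c = begin
    ∑[ j < k ] 𝟙 (greedy k j o ℓ ≟ toℕ c)
      ≡⟨ sum-cong-≗ (λ j → 𝟙-cong (to j) (from j) (greedy k j o ℓ ≟ toℕ c) (c′ Finₚ.≟ j)) ⟩
    ∑[ j < k ] 𝟙 (c′ Finₚ.≟ j)
      ≡⟨ ∑-𝟙-≟ c′ ⟩
    1ℤ ∎
    where
    open ≡-Reasoning
    e = disp o ℓ
    c′ = fromℕ< (n%ℕd<d (+ toℕ c - e) k)
    to : ∀ j → greedy k j o ℓ ≡ toℕ c → c′ ≡ j
    to j g≡c = toℕ-injective (trans (toℕ-fromℕ< _) (%ℕ-transpose e (toℕ<n j) g≡c))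
    from : ∀ j → c′ ≡ j → greedy k j o ℓ ≡ toℕ c
    from j c′≡j = subst (λ x → (+ toℕ j + x) %ℕ k ≡ toℕ c) (neg-involutive e)
      (%ℕ-transpose (- e) (toℕ<n c) (trans (sym (toℕ-fromℕ< _)) (cong toℕ c′≡j)))

  ∑-hits-greedy : ∀ o (L : List ℕ) (c : Fin k) → ∑[ j < k ] (+ hits (greedy k j o) (toℕ c) L) ≡ + length L
  ∑-hits-greedy o []      c = sum-replicate-zero k
  ∑-hits-greedy o (ℓ ∷ L) c = begin
    ∑[ j < k ] (+ hits (greedy k j o) (toℕ c) (ℓ ∷ L))
      ≡⟨ sum-cong-≗ (λ j → +length-filter-∷ (λ x → greedy k j o x ≟ toℕ c) ℓ L) ⟩
    ∑[ j < k ] (𝟙 (greedy k j o ℓ ≟ toℕ c) + + hits (greedy k j o) (toℕ c) L)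
      ≡⟨ ∑-distrib-+ (λ j → 𝟙 (greedy k j o ℓ ≟ toℕ c)) (λ j → + hits (greedy k j o) (toℕ c) L) ⟩
    ∑[ j < k ] 𝟙 (greedy k j o ℓ ≟ toℕ c) + ∑[ j < k ] (+ hits (greedy k j o) (toℕ c) L)
      ≡⟨ cong₂ _+_ (∑-𝟙-greedy≡ o ℓ c) (∑-hits-greedy o L c) ⟩
    1ℤ + + length L ∎
    where open ≡-Reasoning

module Squares where

  open import Data.Nat using (_≤_; _*_; _⊔_; z≤n)
  open import Data.Nat.Properties using (≤-trans; ⊔-lub; *-monoʳ-≤; *-mono-≤; m≤n*m; module ≤-Reasoning)
  open import Data.Integer as ℤ using (ℤ; +_; -[1+_]; ∣_∣; _⊖_; +≤+)
  open import Data.Integer.Properties using (pos-*; m-n≡m⊖n; ∣m⊝n∣≤m⊔n)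
  open import Relation.Binary.PropositionalEquality

  square : ℤ → ℤ
  square i = i ℤ.* i

  square≡+∣∣² : ∀ i → square i ≡ + (∣ i ∣ * ∣ i ∣)
  square≡+∣∣² (+ n)    = sym (pos-* n n)
  square≡+∣∣² -[1+ n ] = refl

  square-nonNeg : ∀ i → ℤ.0ℤ ℤ.≤ square i
  square-nonNeg i = subst (ℤ.0ℤ ℤ.≤_) (sym (square≡+∣∣² i)) (+≤+ z≤n)

  square≤ : ∀ {i n} → ∣ i ∣ ≤ n → square i ℤ.≤ + (n * n)
  square≤ {i} {n} ∣i∣≤n =
    subst (ℤ._≤ + (n * n)) (sym (square≡+∣∣² i)) (+≤+ (*-mono-≤ ∣i∣≤n ∣i∣≤n))

  ∣m*x-y∣≤m*z : ∀ m .{{_ : NonZero m}} {x y z} → x ≤ y → y ≤ z → ∣ + m ℤ.* + x ℤ.- + y ∣ ≤ m * z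
  ∣m*x-y∣≤m*z m {x} {y} {z} x≤y y≤z = begin
    ∣ + m ℤ.* + x ℤ.- + y ∣
      ≡⟨ cong ∣_∣ (trans (cong (ℤ._- + y) (sym (pos-* m x))) (m-n≡m⊖n (m * x) y)) ⟩
    ∣ m * x ⊖ y ∣            ≤⟨ ∣m⊝n∣≤m⊔n (m * x) y ⟩
    m * x ⊔ y                ≤⟨ ⊔-lub (*-monoʳ-≤ m (≤-trans x≤y y≤z)) (≤-trans y≤z (m≤n*m z m)) ⟩
    m * z                    ∎
    where open ≤-Reasoning

module Balancing (k : ℕ) .{{_ : NonZero k}} {m : ℕ} where

  open import Data.Nat using (zero; suc)
  open import Data.Integer using (ℤ; +_; 0ℤ; _+_; _*_; _≤_)
  open import Data.Integer.Properties
    using (≤-reflexive; +-mono-≤; *-monoˡ-≤-nonNeg; *-distribˡ-+; *-distribʳ-+; *-identityˡ; *-zeroʳ;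
           +-identityʳ; module ≤-Reasoning)
  open import Data.Integer.Tactic.RingSolver using (solve-∀)
  open import Data.Fin using (zero; suc)
  open import Data.Vec.Functional using (_∷_)
  open import Data.Product using (∃-syntax; _,_)
  open import Function using (_∘_)
  open import Relation.Binary.PropositionalEquality
  open IntegerSums
  open Squares using (square)

  imbalance : ∀ {s} → (Fin s → Fin k → Fin m → ℤ) → (Fin s → Fin k) → ℤ
  imbalance {s} z φ = ∑[ c < m ] square (∑[ p < s ] z p (φ p) c)

  ∑∑-square-+ : (w : Fin k → Fin m → ℤ) (D : Fin m → ℤ) → (∀ c → ∑[ j < k ] w j c ≡ 0ℤ) →
    ∑[ j < k ] ∑[ c < m ] square (w j c + D c) ≡
    ∑[ j < k ] ∑[ c < m ] square (w j c) + + k * ∑[ c < m ] square (D c)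
  ∑∑-square-+ w D ∑w≡0 = begin
    ∑[ j < k ] ∑[ c < m ] square (w j c + D c)
      ≡⟨ sum-cong-≗ (λ j → trans (sum-cong-≗ (λ c → expand (w j c) (D c)))
                                 (∑-distrib-+ (diagonal j) (cross j))) ⟩
    ∑[ j < k ] (∑[ c < m ] diagonal j c + ∑[ c < m ] cross j c)
      ≡⟨ ∑-distrib-+ (λ j → ∑[ c < m ] diagonal j c) (λ j → ∑[ c < m ] cross j c) ⟩
    ∑[ j < k ] ∑[ c < m ] diagonal j c + ∑[ j < k ] ∑[ c < m ] cross j c
      ≡⟨ cong₂ _+_ ∑∑-diagonal ∑∑-cross ⟩
    (∑[ j < k ] ∑[ c < m ] square (w j c) + + k * ∑[ c < m ] square (D c)) + 0ℤ
      ≡⟨ +-identityʳ _ ⟩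
    ∑[ j < k ] ∑[ c < m ] square (w j c) + + k * ∑[ c < m ] square (D c) ∎
    where
    open ≡-Reasoning
    diagonal cross : Fin k → Fin m → ℤ
    diagonal j c = square (w j c) + square (D c)
    cross j c = (D c + D c) * w j c
    expand : ∀ x d → (x + d) * (x + d) ≡ (x * x + d * d) + (d + d) * x
    expand = solve-∀
    ∑∑-diagonal : ∑[ j < k ] ∑[ c < m ] diagonal j c ≡
                  ∑[ j < k ] ∑[ c < m ] square (w j c) + + k * ∑[ c < m ] square (D c)
    ∑∑-diagonal = begin
      ∑[ j < k ] ∑[ c < m ] diagonal j c
        ≡⟨ sum-cong-≗ (λ j → ∑-distrib-+ (λ c → square (w j c)) (λ c → square (D c))) ⟩
      ∑[ j < k ] (∑[ c < m ] square (w j c) + ∑[ c < m ] square (D c))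
        ≡⟨ ∑-distrib-+ (λ j → ∑[ c < m ] square (w j c)) (λ _ → ∑[ c < m ] square (D c)) ⟩
      ∑[ j < k ] ∑[ c < m ] square (w j c) + ∑[ j < k ] ∑[ c < m ] square (D c)
        ≡⟨ cong (_+_ (∑[ j < k ] ∑[ c < m ] square (w j c))) (∑-const k (∑[ c < m ] square (D c))) ⟩
      ∑[ j < k ] ∑[ c < m ] square (w j c) + + k * ∑[ c < m ] square (D c) ∎
    ∑∑-cross : ∑[ j < k ] ∑[ c < m ] cross j c ≡ 0ℤ
    ∑∑-cross = begin
      ∑[ j < k ] ∑[ c < m ] cross j c
        ≡⟨ ∑-comm cross ⟩
      ∑[ c < m ] ∑[ j < k ] cross j c
        ≡⟨ sum-cong-≗ (λ c → *-distribˡ-sum (D c + D c) (λ j → w j c)) ⟨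
      ∑[ c < m ] ((D c + D c) * ∑[ j < k ] w j c)
        ≡⟨ sum-cong-≗ (λ c → trans (cong (_*_ (D c + D c)) (∑w≡0 c)) (*-zeroʳ (D c + D c))) ⟩
      ∑[ c < m ] 0ℤ
        ≡⟨ sum-replicate-zero m ⟩
      0ℤ ∎

  balancing-step : ∀ {s} (z : Fin (suc s) → Fin k → Fin m → ℤ) (B : ℤ) (φ : Fin s → Fin k) →
    (∀ c → ∑[ j < k ] z zero j c ≡ 0ℤ) → (∀ j → ∑[ c < m ] square (z zero j c) ≤ B) →
    imbalance (z ∘ suc) φ ≤ + s * B → ∃[ j ] imbalance z (j ∷ φ) ≤ + suc s * B
  balancing-step {s} z B φ ∑z≡0 ∑z²≤B φ-balanced =
    ∑≤n*b⇒∃≤b (λ j → imbalance z (j ∷ φ)) (+ suc s * B) (begin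
    ∑[ j < k ] imbalance z (j ∷ φ)
      ≡⟨ ∑∑-square-+ (z zero) (λ c → ∑[ p < s ] z (suc p) (φ p) c) ∑z≡0 ⟩
    ∑[ j < k ] ∑[ c < m ] square (z zero j c) + + k * imbalance (z ∘ suc) φ
      ≤⟨ +-mono-≤ (∑-mono-≤ ∑z²≤B) (*-monoˡ-≤-nonNeg (+ k) φ-balanced) ⟩
    ∑[ j < k ] B + + k * (+ s * B)
      ≡⟨ cong₂ _+_ (∑-const k B) refl ⟩
    + k * B + + k * (+ s * B)
      ≡⟨ *-distribˡ-+ (+ k) B (+ s * B) ⟨
    + k * (B + + s * B)
      ≡⟨ cong (_*_ (+ k)) (trans (*-distribʳ-+ B (+ 1) (+ s)) (cong₂ _+_ (*-identityˡ B) refl)) ⟨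
    + k * (+ suc s * B) ∎)
    where open ≤-Reasoning

  balancing : ∀ {s} (z : Fin s → Fin k → Fin m → ℤ) (B : ℤ) →
    (∀ p c → ∑[ j < k ] z p j c ≡ 0ℤ) → (∀ p j → ∑[ c < m ] square (z p j c) ≤ B) →
    ∃[ φ ] imbalance z φ ≤ + s * B
  balancing {zero}  z B _ _ = (λ ()) , ≤-reflexive (sum-replicate-zero m)
  balancing {suc s} z B ∑z≡0 ∑z²≤B =
    let φ , φ-balanced = balancing (z ∘ suc) B (∑z≡0 ∘ suc) (∑z²≤B ∘ suc)
        j , j∷φ-balanced = balancing-step z B φ (∑z≡0 zero) (∑z²≤B zero) φ-balanced
    in (j ∷ φ) , j∷φ-balanced

module DistinctElements where

  open import Data.Nat using (_<_; _≤_)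
  open import Data.Fin using (zero; suc; fromℕ<)
  open import Data.Fin.Properties using (injective⇒≤; fromℕ<-injective)
  open import Data.List using (List; length; lookup)
  open import Data.List.Relation.Unary.All as All using (All)
  open import Data.List.Relation.Unary.AllPairs using (_∷_)
  open import Data.List.Relation.Unary.Unique.Propositional using (Unique)
  open import Data.List.Membership.Propositional.Properties using (∈-lookup)
  open import Relation.Binary.PropositionalEquality
  open import Relation.Nullary using (contradiction)

  Unique⇒lookup-injective : ∀ {a} {A : Set a} {xs : List A} → Unique xs →
    ∀ {i j} → lookup xs i ≡ lookup xs j → i ≡ j
  Unique⇒lookup-injective (x∉xs ∷ xs!) {zero}  {zero}  _  = refl
  Unique⇒lookup-injective (x∉xs ∷ xs!) {zero}  {suc j} eq = contradiction eq (All.lookup x∉xs (∈-lookup j))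
  Unique⇒lookup-injective (x∉xs ∷ xs!) {suc i} {zero}  eq = contradiction (sym eq) (All.lookup x∉xs (∈-lookup i))
  Unique⇒lookup-injective (x∉xs ∷ xs!) {suc i} {suc j} eq = cong suc (Unique⇒lookup-injective xs! eq)

  Unique-bounded⇒length≤ : ∀ {t} {xs : List ℕ} → Unique xs → All (_< t) xs → length xs ≤ t
  Unique-bounded⇒length≤ {t} {xs} xs! xs<t =
    injective⇒≤ {f = bounded} (λ eq → Unique⇒lookup-injective xs! (fromℕ<-injective _ _ (below _) (below _) eq))
    where
    below : ∀ i → lookup xs i < t
    below i = All.lookup xs<t (∈-lookup i)
    bounded : Fin (length xs) → Fin t
    bounded i = fromℕ< (below i)

module Subpaths {s : ℕ} where

  open import Data.Nat using (_<_; _≤_)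
  open import Data.Nat.Properties using (≤-total; ≤-refl)
  open import Data.Integer using (+_; 1ℤ; _+_)
  import Data.Fin.Properties as Finₚ
  open import Data.List using (List; []; _∷_; length; map; filter)
  open import Data.List.Properties using (length-map)
  open import Data.List.Relation.Unary.All as All using (All)
  open import Data.List.Relation.Unary.All.Properties
    using (all-filter) renaming (map⁺ to All-map⁺; filter⁺ to All-filter⁺)
  open import Data.List.Relation.Unary.AllPairs using (AllPairs; []; _∷_)
  open import Data.List.Relation.Unary.Unique.Propositional using (Unique)
  open import Data.Product using (_,_; proj₁)
  open import Data.Sum using (inj₁; inj₂)
  open import Relation.Binary.PropositionalEquality
  open import Relation.Nullary using (yes; no)
  open import Defs using (Subpath; path; start; finish; OnSubpath; Disjoint; ValidSubpath)
  open IntegerSums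
  open Counting
  open DistinctElements

  startsOn : Fin s → List (Subpath s) → List ℕ
  startsOn p Q = map start (filter (λ q → path q Finₚ.≟ p) Q)

  +length-startsOn-∷ : ∀ p q Q → + length (startsOn p (q ∷ Q)) ≡ 𝟙 (path q Finₚ.≟ p) + + length (startsOn p Q)
  +length-startsOn-∷ p q Q = begin
    + length (startsOn p (q ∷ Q))
      ≡⟨ cong +_ (length-map start (filter (λ q → path q Finₚ.≟ p) (q ∷ Q))) ⟩
    + length (filter (λ q → path q Finₚ.≟ p) (q ∷ Q))
      ≡⟨ +length-filter-∷ (λ q → path q Finₚ.≟ p) q Q ⟩
    𝟙 (path q Finₚ.≟ p) + + length (filter (λ q → path q Finₚ.≟ p) Q)
      ≡⟨ cong (_+_ (𝟙 (path q Finₚ.≟ p))) (cong +_ (length-map start (filter (λ q → path q Finₚ.≟ p) Q))) ⟨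
    𝟙 (path q Finₚ.≟ p) + + length (startsOn p Q) ∎
    where open ≡-Reasoning

  ∑-length-startsOn : ∀ Q → ∑[ p < s ] (+ length (startsOn p Q)) ≡ + length Q
  ∑-length-startsOn []      = sum-replicate-zero s
  ∑-length-startsOn (q ∷ Q) = begin
    ∑[ p < s ] (+ length (startsOn p (q ∷ Q)))
      ≡⟨ sum-cong-≗ (λ p → +length-startsOn-∷ p q Q) ⟩
    ∑[ p < s ] (𝟙 (path q Finₚ.≟ p) + + length (startsOn p Q))
      ≡⟨ ∑-distrib-+ (λ p → 𝟙 (path q Finₚ.≟ p)) (λ p → + length (startsOn p Q)) ⟩
    ∑[ p < s ] 𝟙 (path q Finₚ.≟ p) + ∑[ p < s ] (+ length (startsOn p Q))
      ≡⟨ cong₂ _+_ (∑-𝟙-≟ (path q)) (∑-length-startsOn Q) ⟩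
    1ℤ + + length Q ∎
    where open ≡-Reasoning

  start-onSubpath : ∀ (q : Subpath s) → OnSubpath q (path q) (start q)
  start-onSubpath q with ≤-total (start q) (finish q)
  ... | inj₁ start≤finish = refl , inj₁ (≤-refl , start≤finish)
  ... | inj₂ finish≤start = refl , inj₂ (finish≤start , ≤-refl)

  disjoint⇒start≢ : ∀ {q q′ : Subpath s} → Disjoint q q′ → path q′ ≡ path q → start q ≢ start q′
  disjoint⇒start≢ {q} {q′} q∩q′=∅ same-path same-start = q∩q′=∅ (path q) (start q) (start-onSubpath q)
    (subst₂ (OnSubpath q′) same-path (sym same-start) (start-onSubpath q′))

  startsOn-unique : ∀ p {Q} → AllPairs Disjoint Q → Unique (startsOn p Q)
  startsOn-unique p {[]}    []                    = []
  startsOn-unique p {q ∷ Q} (q∩Q=∅ ∷ Q-disjoint) with path q Finₚ.≟ p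
  ... | yes refl = All-map⁺ (All.zipWith (λ (q∩q′=∅ , same-path) → disjoint⇒start≢ q∩q′=∅ same-path)
                     (All-filter⁺ (λ q′ → path q′ Finₚ.≟ path q) q∩Q=∅ , all-filter (λ q′ → path q′ Finₚ.≟ path q) Q))
                   ∷ startsOn-unique p Q-disjoint
  ... | no  _    = startsOn-unique p Q-disjoint

  length-startsOn≤ : ∀ {t} p {Q} → All (ValidSubpath t) Q → AllPairs Disjoint Q → length (startsOn p Q) ≤ t
  length-startsOn≤ p valid disjoint = Unique-bounded⇒length≤ (startsOn-unique p disjoint)
    (All-map⁺ (All-filter⁺ (λ q → path q Finₚ.≟ p) (All.map proj₁ valid)))

module Loads (k : ℕ) .{{_ : NonZero k}} {s : ℕ} (ori : Fin s → Orientation) where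

  open import Data.Nat as ℕ using (_≤_; z≤n)
  open import Data.Nat.Properties using (_≟_)
  open import Data.Integer as ℤ using (ℤ; +_; 0ℤ; _+_; _*_; _-_; -_; ∣_∣; +≤+)
  open import Data.Integer.Properties using (*-identityˡ; +-identityˡ; drop‿+≤+)
  import Data.Integer.Properties as ℤ
  open import Data.Integer.Tactic.RingSolver using (solve-∀)
  open import Data.Fin using (toℕ; _↑ˡ_; _↑ʳ_; splitAt)
  import Data.Fin.Properties as Finₚ
  open import Data.List using (List; []; _∷_; length; downFrom)
  open import Data.Vec.Functional using (_++_)
  open import Data.Vec.Functional.Properties using (lookup-++ˡ; lookup-++ʳ)
  open import Data.Product using (∃-syntax; _×_; _,_; proj₁; proj₂)
  open import Data.Sum using (inj₁; inj₂)
  open import Relation.Binary.PropositionalEquality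
  open import Relation.Nullary using (yes; no)
  open import Defs using (greedy; aCount; nCount; path; start)
  open IntegerSums
  open Counting
  open GreedyEmbedding k
  open Squares
  open Subpaths {s}

  load : (Fin s → List ℕ) → (Fin s → Fin k) → Fin k → ℤ
  load L φ i = ∑[ p < s ] (+ hits (greedy k (φ p) (ori p)) (toℕ i) (L p))

  +aCount≡load : ∀ t φ i → + aCount k s t ori φ i ≡ load (λ _ → downFrom t) φ i
  +aCount≡load t φ i = trans (+-sumFin s _)
    (sum-cong-≗ (λ p → +countUpTo≡hits-downFrom (greedy k (φ p) (ori p)) (toℕ i) t))

  +hits-startsOn-∷ : ∀ f c p q Q → + hits f c (startsOn p (q ∷ Q)) ≡
    𝟙 (path q Finₚ.≟ p) * 𝟙 (f (start q) ≟ c) + + hits f c (startsOn p Q)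
  +hits-startsOn-∷ f c p q Q with path q Finₚ.≟ p
  ... | yes _ = trans (+length-filter-∷ (λ ℓ → f ℓ ≟ c) (start q) (startsOn p Q))
                      (cong (λ x → x + + hits f c (startsOn p Q)) (sym (*-identityˡ (𝟙 (f (start q) ≟ c)))))
  ... | no  _ = sym (+-identityˡ _)

  +nCount≡load : ∀ φ Q i → + nCount k s ori φ Q i ≡ load (λ p → startsOn p Q) φ i
  +nCount≡load φ []      i = sym (sum-replicate-zero s)
  +nCount≡load φ (q ∷ Q) i = begin
    + nCount k s ori φ (q ∷ Q) i
      ≡⟨ +nCount-∷ ⟩
    𝟙 (g (path q) (start q) ≟ toℕ i) + + nCount k s ori φ Q i
      ≡⟨ cong₂ _+_ (∑-𝟙-≟-* (path q) (λ p → 𝟙 (g p (start q) ≟ toℕ i))) (sym (+nCount≡load φ Q i)) ⟨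
    ∑[ p < s ] (𝟙 (path q Finₚ.≟ p) * 𝟙 (g p (start q) ≟ toℕ i)) + load (λ p → startsOn p Q) φ i
      ≡⟨ ∑-distrib-+ (λ p → 𝟙 (path q Finₚ.≟ p) * 𝟙 (g p (start q) ≟ toℕ i)) _ ⟨
    ∑[ p < s ] (𝟙 (path q Finₚ.≟ p) * 𝟙 (g p (start q) ≟ toℕ i) + + hits (g p) (toℕ i) (startsOn p Q))
      ≡⟨ sum-cong-≗ (λ p → +hits-startsOn-∷ (g p) (toℕ i) p q Q) ⟨
    load (λ p → startsOn p (q ∷ Q)) φ i ∎
    where
    open ≡-Reasoning
    g : Fin s → ℕ → ℕ
    g p = greedy k (φ p) (ori p)
    +nCount-∷ : + nCount k s ori φ (q ∷ Q) i ≡ 𝟙 (g (path q) (start q) ≟ toℕ i) + + nCount k s ori φ Q i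
    +nCount-∷ with g (path q) (start q) ≟ toℕ i
    ... | yes hit  = sym (cong (λ x → x + + nCount k s ori φ Q i) (𝟙-yes (g (path q) (start q) ≟ toℕ i) hit))
    ... | no  miss = sym (cong (λ x → x + + nCount k s ori φ Q i) (𝟙-no (g (path q) (start q) ≟ toℕ i) miss))

  -- Scaled by k, so that the deviation of a count from its mean stays an integer.
  deviation : (Fin s → List ℕ) → Fin s → Fin k → Fin k → ℤ
  deviation L p j c = + k * + hits (greedy k j (ori p)) (toℕ c) (L p) - + length (L p)

  ∑-deviation-over-starts : ∀ L p c → ∑[ j < k ] deviation L p j c ≡ 0ℤ
  ∑-deviation-over-starts L p c = begin
    ∑[ j < k ] deviation L p j c                ≡⟨ ∑-distrib-+ (λ j → + k * h j) (λ _ → - T) ⟩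
    ∑[ j < k ] (+ k * h j) + ∑[ j < k ] (- T)   ≡⟨ cong₂ _+_ (*-distribˡ-sum (+ k) h) (sym (∑-const k (- T))) ⟨
    + k * ∑[ j < k ] h j + + k * - T
      ≡⟨ cong (λ x → + k * x + + k * - T) (∑-hits-greedy (ori p) (L p) c) ⟩
    + k * T + + k * - T                         ≡⟨ cancel (+ k) T ⟩
    0ℤ                                          ∎
    where
    open ≡-Reasoning
    T = + length (L p)
    h : Fin k → ℤ
    h j = + hits (greedy k j (ori p)) (toℕ c) (L p)
    cancel : ∀ k T → k * T + k * - T ≡ 0ℤ
    cancel = solve-∀

  ∑-deviation-over-paths : ∀ L φ c →
    ∑[ p < s ] deviation L p (φ p) c ≡ + k * load L φ c - ∑[ p < s ] (+ length (L p))
  ∑-deviation-over-paths L φ c = trans (∑-distrib-+ (λ p → + k * h p) (λ p → - + length (L p)))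
    (cong₂ _+_ (sym (*-distribˡ-sum (+ k) h)) (∑-neg s (λ p → + length (L p))))
    where
    h : Fin s → ℤ
    h p = + hits (greedy k (φ p) (ori p)) (toℕ c) (L p)

  hits≤length : ∀ (L : Fin s → List ℕ) p j c → hits (greedy k j (ori p)) (toℕ c) (L p) ≤ length (L p)
  hits≤length L p j c =
    drop‿+≤+ (subst (h j ℤ.≤_) (∑-hits-greedy (ori p) (L p) c) (term≤∑ {f = h} (λ _ → +≤+ z≤n) j))
    where
    h : Fin k → ℤ
    h j′ = + hits (greedy k j′ (ori p)) (toℕ c) (L p)

  ∣deviation∣≤ : ∀ {t} L → (∀ p → length (L p) ≤ t) → ∀ p j c → ∣ deviation L p j c ∣ ≤ k ℕ.* t
  ∣deviation∣≤ L L≤t p j c = ∣m*x-y∣≤m*z k (hits≤length L p j c) (L≤t p)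

  balanced-starts : ∀ {t} (L L′ : Fin s → List ℕ) →
    (∀ p → length (L p) ≤ t) → (∀ p → length (L′ p) ≤ t) →
    let B = + (k ℕ.+ k) * + (k ℕ.* t ℕ.* (k ℕ.* t)) in
    ∃[ φ ] ∀ i → square (+ k * load L  φ i - ∑[ p < s ] (+ length (L  p))) ℤ.≤ + s * B
               × square (+ k * load L′ φ i - ∑[ p < s ] (+ length (L′ p))) ℤ.≤ + s * B
  balanced-starts {t} L L′ L≤t L′≤t = φ , λ i →
      coordinate-bound L  (i ↑ˡ k) i (λ p j → lookup-++ˡ (deviation L p j) (deviation L′ p j) i)
    , coordinate-bound L′ (k ↑ʳ i) i (λ p j → lookup-++ʳ (deviation L p j) (deviation L′ p j) i)
    where
    B = + (k ℕ.+ k) * + (k ℕ.* t ℕ.* (k ℕ.* t))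
    -- Both families of counts are balanced at once by concatenating their coordinates.
    z : Fin s → Fin k → Fin (k ℕ.+ k) → ℤ
    z p j = deviation L p j ++ deviation L′ p j
    ∑z≡0 : ∀ p c → ∑[ j < k ] z p j c ≡ 0ℤ
    ∑z≡0 p c with splitAt k c
    ... | inj₁ i = ∑-deviation-over-starts L  p i
    ... | inj₂ i = ∑-deviation-over-starts L′ p i
    ∣z∣≤ : ∀ p j c → ∣ z p j c ∣ ≤ k ℕ.* t
    ∣z∣≤ p j c with splitAt k c
    ... | inj₁ i = ∣deviation∣≤ L  L≤t  p j i
    ... | inj₂ i = ∣deviation∣≤ L′ L′≤t p j i
    ∑z²≤B : ∀ p j → ∑[ c < k ℕ.+ k ] square (z p j c) ℤ.≤ B
    ∑z²≤B p j = subst (∑[ c < k ℕ.+ k ] square (z p j c) ℤ.≤_)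
      (∑-const (k ℕ.+ k) (+ (k ℕ.* t ℕ.* (k ℕ.* t)))) (∑-mono-≤ (λ c → square≤ {z p j c} (∣z∣≤ p j c)))
    open Balancing k {k ℕ.+ k}
    balanced = balancing z B ∑z≡0 ∑z²≤B
    φ = proj₁ balanced
    coordinate-bound : ∀ M c i → (∀ p j → z p j c ≡ deviation M p j i) →
      square (+ k * load M φ i - ∑[ p < s ] (+ length (M p))) ℤ.≤ + s * B
    coordinate-bound M c i z≡deviation = subst (λ x → square x ℤ.≤ + s * B)
      (trans (sum-cong-≗ (λ p → z≡deviation p (φ p))) (∑-deviation-over-paths M φ i))
      (ℤ.≤-trans (term≤∑ (λ c → square-nonNeg (∑[ p < s ] z p (φ p) c)) c) (proj₂ balanced))

module Estimates where

  open import Data.Nat using (zero; suc; _+_; _*_; _≤_)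
  open import Data.Nat.Properties
    using (≤-trans; *-monoˡ-≤; *-mono-<; m≤n*m; ≰⇒>; <⇒≱; _≤?_; *-identityʳ; *-identityˡ;
           module ≤-Reasoning)
  open import Data.Nat.Tactic.RingSolver using (solve)
  open import Data.List using ([]; _∷_)
  open import Data.Integer as ℤ using (ℤ; +_; -[1+_]; ∣_∣; +≤+)
  open import Data.Integer.Properties using (pos-*; drop‿+≤+)
  import Data.Integer.Tactic.RingSolver as ℤ-Solver
  open import Data.Rational as ℚ using (ℚ; mkℚ; 0ℚ; toℚᵘ)
  open import Data.Rational.Properties
    using (toℚᵘ-cancel-≤; toℚᵘ-fromℚᵘ; toℚᵘ-homo-∣-∣; toℚᵘ-homo-+; toℚᵘ-homo‿-; toℚᵘ-homo-*)
  open import Data.Rational.Unnormalised as ℚᵘ using (mkℚᵘ; _≃_; *≤*)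
  import Data.Rational.Unnormalised.Properties as ℚᵘ
  open import Relation.Binary.PropositionalEquality
  open import Relation.Nullary using (yes; no; contradiction)
  open Squares using (square; square≡+∣∣²)

  square-cancel-≤ : ∀ {a b} → a * a ≤ b * b → a ≤ b
  square-cancel-≤ {a} {b} a²≤b² with a ≤? b
  ... | yes a≤b = a≤b
  ... | no  a≰b = contradiction a²≤b² (<⇒≱ (*-mono-< (≰⇒> a≰b) (≰⇒> a≰b)))

  ≤-of-squares : ∀ {e d m s x} → e * e ≤ s * (m * (x * x)) → m * d * d ≤ s → e * d ≤ s * x
  ≤-of-squares {e} {d} {m} {s} {x} e²≤smx² md²≤s = square-cancel-≤ (begin
    e * d * (e * d)              ≡⟨ solve (e ∷ d ∷ []) ⟩
    e * e * (d * d)              ≤⟨ *-monoˡ-≤ (d * d) e²≤smx² ⟩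
    s * (m * (x * x)) * (d * d)  ≡⟨ solve (s ∷ m ∷ x ∷ d ∷ []) ⟩
    m * d * d * (s * (x * x))    ≤⟨ *-monoˡ-≤ (s * (x * x)) md²≤s ⟩
    s * (s * (x * x))            ≡⟨ solve (s ∷ x ∷ []) ⟩
    s * x * (s * x)              ∎)
    where open ≤-Reasoning

  toℚᵘ-/ : ∀ i n .{{_ : NonZero n}} → toℚᵘ (i ℚ./ n) ≃ i ℚᵘ./ n
  toℚᵘ-/ i (suc n) = toℚᵘ-fromℚᵘ (mkℚᵘ i n)

  -- Cross-multiplication: |a − b/k| ≤ (n/d)·x  ⇔  |ka − b|·d ≤ n·k·x, and n ≥ 1.
  ∣a-b/k∣≤γ*x : ∀ (γ : ℚ) → 0ℚ ℚ.< γ → ∀ k .{{_ : NonZero k}} a b x →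
    ∣ + k ℤ.* + a ℤ.- + b ∣ * ℚ.denominatorℕ γ ≤ k * x →
    ℚ.∣ + a ℚ./ 1 ℚ.- + b ℚ./ k ∣ ℚ.≤ γ ℚ.* (+ x ℚ./ 1)
  ∣a-b/k∣≤γ*x (mkℚ -[1+ _ ] _ _) (ℚ.*<* ())
  ∣a-b/k∣≤γ*x (mkℚ (+ zero) _ _) (ℚ.*<* (ℤ.+<+ ()))
  ∣a-b/k∣≤γ*x γ@(mkℚ (+ suc n) d-1 _) _ k@(suc _) a b x e*d≤k*x =
    toℚᵘ-cancel-≤ (ℚᵘ.≤-respˡ-≃ (ℚᵘ.≃-sym lhs≃) (ℚᵘ.≤-respʳ-≃ (ℚᵘ.≃-sym rhs≃) cross-multiplied))
    where
    e = ∣ + k ℤ.* + a ℤ.- + b ∣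
    lhs≃ : toℚᵘ (ℚ.∣ + a ℚ./ 1 ℚ.- + b ℚ./ k ∣) ≃ ℚᵘ.∣ + a ℚᵘ./ 1 ℚᵘ.- + b ℚᵘ./ k ∣
    lhs≃ = ℚᵘ.≃-trans (toℚᵘ-homo-∣-∣ (+ a ℚ./ 1 ℚ.- + b ℚ./ k)) (ℚᵘ.∣-∣-cong
      (ℚᵘ.≃-trans (toℚᵘ-homo-+ (+ a ℚ./ 1) (ℚ.- (+ b ℚ./ k)))
        (ℚᵘ.+-cong (toℚᵘ-/ (+ a) 1)
                   (ℚᵘ.≃-trans (toℚᵘ-homo‿- (+ b ℚ./ k)) (ℚᵘ.-‿cong (toℚᵘ-/ (+ b) k))))))
    rhs≃ : toℚᵘ (γ ℚ.* (+ x ℚ./ 1)) ≃ mkℚᵘ (+ suc n) d-1 ℚᵘ.* (+ x ℚᵘ./ 1)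
    rhs≃ = ℚᵘ.≃-trans (toℚᵘ-homo-* γ (+ x ℚ./ 1)) (ℚᵘ.*-congˡ (toℚᵘ-/ (+ x) 1))
    lhs-numerator : + ∣ + a ℤ.* + k ℤ.+ (ℤ.- + b) ℤ.* + 1 ∣ ℤ.* + (suc d-1 * 1) ≡ + (e * suc d-1)
    lhs-numerator = trans
      (cong₂ (λ i j → + ∣ i ∣ ℤ.* + j) (reorder (+ a) (+ k) (+ b)) (*-identityʳ (suc d-1)))
      (sym (pos-* e (suc d-1)))
      where
      reorder : ∀ a k b → a ℤ.* k ℤ.+ (ℤ.- b) ℤ.* + 1 ≡ k ℤ.* a ℤ.- b
      reorder = ℤ-Solver.solve-∀
    rhs-numerator : (+ suc n ℤ.* + x) ℤ.* + (1 * k) ≡ + (suc n * (k * x))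
    rhs-numerator = begin
      (+ suc n ℤ.* + x) ℤ.* + (1 * k)  ≡⟨ cong (λ j → (+ suc n ℤ.* + x) ℤ.* + j) (*-identityˡ k) ⟩
      (+ suc n ℤ.* + x) ℤ.* + k        ≡⟨ reorder (+ suc n) (+ x) (+ k) ⟩
      + suc n ℤ.* (+ k ℤ.* + x)        ≡⟨ cong (+ suc n ℤ.*_) (pos-* k x) ⟨
      + suc n ℤ.* + (k * x)            ≡⟨ pos-* (suc n) (k * x) ⟨
      + (suc n * (k * x))              ∎
      where
      open ≡-Reasoning
      reorder : ∀ n x k → (n ℤ.* x) ℤ.* k ≡ n ℤ.* (k ℤ.* x)
      reorder = ℤ-Solver.solve-∀
    cross-multiplied : ℚᵘ.∣ + a ℚᵘ./ 1 ℚᵘ.- + b ℚᵘ./ k ∣ ℚᵘ.≤ mkℚᵘ (+ suc n) d-1 ℚᵘ.* (+ x ℚᵘ./ 1)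
    cross-multiplied = *≤* (subst₂ ℤ._≤_ (sym lhs-numerator) (sym rhs-numerator)
      (+≤+ (≤-trans e*d≤k*x (m≤n*m (k * x) (suc n)))))

  -- γ ≥ 1/d for the denominator d of γ, so s ≥ 2k·d² makes √(2ks)·kt ≤ γ·k·st.
  distance-bound : ∀ (γ : ℚ) → 0ℚ ℚ.< γ → ∀ k .{{_ : NonZero k}} {a b s t} →
    (k + k) * ℚ.denominatorℕ γ * ℚ.denominatorℕ γ ≤ s →
    square (+ k ℤ.* + a ℤ.- + b) ℤ.≤ + s ℤ.* (+ (k + k) ℤ.* + (k * t * (k * t))) →
    ℚ.∣ + a ℚ./ 1 ℚ.- + b ℚ./ k ∣ ℚ.≤ γ ℚ.* (+ (s * t) ℚ./ 1)
  distance-bound γ 0<γ k {a} {b} {s} {t} s₀≤s deviation² =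
    ∣a-b/k∣≤γ*x γ 0<γ k a b (s * t) (subst (e * ℚ.denominatorℕ γ ≤_) reorder
      (≤-of-squares {e} {ℚ.denominatorℕ γ} {k + k} {s} {k * t}
        (drop‿+≤+ (subst₂ ℤ._≤_ (square≡+∣∣² (+ k ℤ.* + a ℤ.- + b)) +-bound deviation²)) s₀≤s))
    where
    e = ∣ + k ℤ.* + a ℤ.- + b ∣
    reorder : s * (k * t) ≡ k * (s * t)
    reorder = solve (s ∷ k ∷ t ∷ [])
    +-bound : + s ℤ.* (+ (k + k) ℤ.* + (k * t * (k * t))) ≡ + (s * ((k + k) * (k * t * (k * t))))
    +-bound = trans (cong (+ s ℤ.*_) (sym (pos-* (k + k) _))) (sym (pos-* s _))

open import Defs
open import Data.Nat using (_+_; _*_; _≤_)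
open import Data.Nat.Properties using (≤-reflexive)
open import Data.Integer as ℤ using (+_)
import Data.Integer.Properties as ℤ
open import Data.Rational using (ℚ; 0ℚ; _/_; _-_; ∣_∣) renaming (_*_ to _*ℚ_; _≤_ to _≤ℚ_; _<_ to _<ℚ_)
open import Data.List using (List; length; downFrom)
open import Data.List.Properties using (length-downFrom)
open import Data.List.Relation.Unary.All using (All)
open import Data.List.Relation.Unary.AllPairs using (AllPairs)
open import Data.Product using (_×_; ∃-syntax; _,_; proj₁; proj₂)
open import Relation.Binary.PropositionalEquality using (cong; sym; subst₂; trans)
open IntegerSums using (∑-const)
open Subpaths using (startsOn; length-startsOn≤; ∑-length-startsOn)
open Squares using (square)
open Estimates using (distance-bound)

mainTheorem14 : (k : ℕ) → .{{_ : NonZero k}} → (γ : ℚ) → 0ℚ <ℚ γ →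
    ∃[ s₀ ] ∀ (s : ℕ) → s₀ ≤ s →
    ∀ (t : ℕ) → 1 ≤ t →
    ∀ (R : Fin k → Fin k → Set) → IsHamCycleOrder k R →
    ∀ (ori : Fin s → Orientation) →
    ∀ (Q : List (Subpath s)) → All (ValidSubpath t) Q → AllPairs Disjoint Q →
    ∃[ φ ] ∀ (i : Fin k) →
      (∣ (+ aCount k s t ori φ i) / 1 - (+ (s * t)) / k ∣ ≤ℚ γ *ℚ ((+ (s * t)) / 1))
      × (∣ (+ nCount k s ori φ Q i) / 1 - (+ length Q) / k ∣ ≤ℚ γ *ℚ ((+ (s * t)) / 1))
mainTheorem14 k γ 0<γ =
  (k + k) * ℚ.denominatorℕ γ * ℚ.denominatorℕ γ , λ s s₀≤s t _ _ _ ori Q valid disjoint →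
  let open Loads k ori
      vertices = λ (_ : Fin s) → downFrom t
      φ , balanced = balanced-starts vertices (λ p → startsOn p Q)
        (λ _ → ≤-reflexive (length-downFrom t)) (λ p → length-startsOn≤ p valid disjoint)
      deviation²≤ = λ a n → square (+ k ℤ.* a ℤ.- n) ℤ.≤ + s ℤ.* (+ (k + k) ℤ.* + (k * t * (k * t)))
      ∑-length-vertices =
        trans (∑-const s _) (trans (cong (λ n → + s ℤ.* + n) (length-downFrom t)) (sym (ℤ.pos-* s t)))
  in φ , λ i →
       distance-bound γ 0<γ k s₀≤s
         (subst₂ deviation²≤ (sym (+aCount≡load t φ i)) ∑-length-vertices (proj₁ (balanced i)))
     , distance-bound γ 0<γ k s₀≤s
         (subst₂ deviation²≤ (sym (+nCount≡load φ Q i)) (∑-length-startsOn Q) (proj₂ (balanced i)))
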